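{- Let $T$ be a tree of order $n$ and diameter $d \geq 3$. Then $\xi^{c}(T) \geq \xi^{c}(V_{n,d})$.
   Context: For a vertex $v$, $\epsilon(v)=\max_{u} d(u,v)$ is its eccentricity ($d(u,v)$ the shortest-path distance) and ${\rm d}(v)$ its degree. The eccentric connectivity index is $\xi^{c}(G) = \sum_{v \in V(G)} \epsilon(v)\,{\rm d}(v)$. The volcano graph $V_{n,d}$ is obtained from a path $P_{d+1}$ and a set $S$ of $n-d-1$ further vertices by joining each vertex of $S$ to a central vertex of $P_{d+1}$ (the unique middle vertex if $d$ is even, one of the two middle vertices if $d$ is odd); its eccentric connectivity index does not depend on these choices and equals $nd+n+\frac{d^{2}}{2}-2d-1$ for $d$ even and $nd+2n+\frac{d^{2}}{2}-3d-\frac{3}{2}$ for $d$ odd. -}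

module Defs where

open import Data.Nat using (ℕ; zero; suc; _+_; _*_; _≤_; _⊔_; _%_)
open import Data.Bool using (Bool; true; false; if_then_else_)
open import Data.Fin using (Fin)
open import Data.List using (List; []; _∷_; _++_; length; map; foldr; allFin)
open import Data.Nat.ListAction using (sum)
open import Data.Unit using (⊤)
open import Data.List.Relation.Unary.Unique.Propositional using (Unique)
open import Data.Product using (Σ; _×_; ∃; ∃-syntax)
open import Relation.Nullary using (¬_)
open import Relation.Binary.PropositionalEquality using (_≡_)

record Graph (n : ℕ) : Set where
  field
    adj    : Fin n → Fin n → Bool
    sym    : ∀ u v → adj u v ≡ adj v u
    irrefl : ∀ v → adj v v ≡ false
open Graph public

module _ {n : ℕ} (G : Graph n) where

  Adj : Fin n → Fin n → Set
  Adj u v = adj G u v ≡ true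

  data Walk : Fin n → Fin n → ℕ → Set where
    nil  : ∀ {u} → Walk u u zero
    cons : ∀ {u w v k} → Adj u w → Walk w v k → Walk u v (suc k)

  Connected : Set
  Connected = ∀ u v → ∃[ k ] Walk u v k

  Chain : List (Fin n) → Set
  Chain []           = ⊤
  Chain (x ∷ [])     = ⊤
  Chain (x ∷ y ∷ xs) = Adj x y × Chain (y ∷ xs)

  Cycle : Set
  Cycle = Σ (Fin n) λ x → Σ (List (Fin n)) λ xs →
            Unique (x ∷ xs) × (2 ≤ length xs) × Chain (x ∷ xs ++ x ∷ [])

  Acyclic : Set
  Acyclic = ¬ Cycle

  IsTree : Set
  IsTree = Connected × Acyclic

  IsDist : Fin n → Fin n → ℕ → Set
  IsDist u v k = Walk u v k × (∀ m → Walk u v m → k ≤ m)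

  degree : Fin n → ℕ
  degree v = sum (map (λ w → if adj G v w then 1 else 0) (allFin n))

  module _ (dist : Fin n → Fin n → ℕ) where

    ecc : Fin n → ℕ
    ecc v = foldr _⊔_ 0 (map (λ u → dist u v) (allFin n))

    diameter : ℕ
    diameter = foldr _⊔_ 0 (map ecc (allFin n))

    ξᶜ : ℕ
    ξᶜ = sum (map (λ v → ecc v * degree v) (allFin n))

-- "x ≥ ξ^c(V_{n,d})", multiplied by 2 and with subtracted terms moved
-- to the left (to stay in ℕ):
--   d even: ξ^c(V_{n,d}) = nd + n + d²/2 − 2d − 1
--   d odd : ξ^c(V_{n,d}) = nd + 2n + d²/2 − 3d − 3/2
AtLeastVolcano : ℕ → ℕ → ℕ → Set
AtLeastVolcano n d x =
  (d % 2 ≡ 0 → 2 * n * d + 2 * n + d * d ≤ 2 * x + 4 * d + 2) ×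
  (d % 2 ≡ 1 → 2 * n * d + 4 * n + d * d ≤ 2 * x + 6 * d + 3)

module Submission where

-- Root T at one end of a diametral path a ⋯ root of length d, the spine. Since every edge is the
-- parent edge of exactly one of its ends, ξᶜ(T) = Σ_{w ≠ root} (ε(w) + ε(parent w)). A spine vertex at
-- level k has ε ≥ max(k, d − k), so the spine edges contribute at least ξᶜ(P_{d+1}). A vertex w off
-- the spine has d(a,w) + d(w,root) ≥ d + 2 (geodesics in a tree are unique, and a tree is bipartite),
-- so its edge contributes at least d + 1, or d + 2 when d is odd. Summing over the d spine edges and
-- the n − 1 − d others gives exactly ξᶜ(V_{n,d}).

open import Defs
open import Data.Nat using (ℕ; zero; suc; _+_; _*_; _∸_; _≤_; _<_; _⊔_; _%_; _/_; z≤n; s≤s; s≤s⁻¹; pred)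
open import Data.Nat.DivMod using (m≡m%n+[m/n]*n)
open import Data.Nat.Properties renaming (_≟_ to _≟ℕ_)
open import Data.Nat.GeneralisedArithmetic using (iterate)
open import Data.Nat.Tactic.RingSolver using (solve-∀)
open import Data.Bool using (Bool; true; false; if_then_else_)
open import Data.Fin using (Fin; toℕ) renaming (zero to fzero; suc to fsuc)
open import Data.Fin.Properties using (_≟_; toℕ<n)
open import Data.List using (List; []; _∷_; _++_; length; map; foldr; allFin; tabulate)
import Data.List.Properties as List
import Data.Nat.ListAction as List
open import Data.List.Membership.Propositional using (_∈_)
open import Data.List.Membership.Propositional.Properties using (∈-map⁺; ∈-map⁻; ∈-allFin)
open import Data.List.Relation.Unary.Any using (here; there)
open import Data.List.Relation.Unary.All as All using (All; []; _∷_)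
import Data.List.Relation.Unary.All.Properties as All
open import Data.List.Relation.Unary.AllPairs using ([]; _∷_)
import Data.List.Relation.Unary.AllPairs.Properties as AllPairs
open import Data.List.Relation.Unary.Unique.Propositional using (Unique)
open import Data.Unit using (tt)
open import Data.Product using (_×_; _,_; proj₁; proj₂; ∃-syntax)
open import Data.Sum using (_⊎_; inj₁; inj₂)
open import Function using (_∘_; id)
open import Relation.Nullary using (¬_; Dec; does; yes; no; ¬?; _×-dec_; contradiction)
open import Relation.Nullary.Decidable using (dec-true; dec-false)
open import Relation.Binary using (tri<; tri≈; tri>)
open import Relation.Binary.PropositionalEquality as ≡
  using (_≡_; _≢_; refl; cong; cong₂; subst; trans; ≢-sym; module ≡-Reasoning)
open import Algebra.Properties.Semiring.Sum +-*-semiring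
  using (sum; sum-syntax; ∑-distrib-+; ∑-comm; *-distribˡ-sum; sum-cong-≗; sum-replicate-zero)

∑-mono-≤ : ∀ {n} {f g : Fin n → ℕ} → (∀ i → f i ≤ g i) → sum f ≤ sum g
∑-mono-≤ {zero}  f≤g = z≤n
∑-mono-≤ {suc n} f≤g = +-mono-≤ (f≤g fzero) (∑-mono-≤ (f≤g ∘ fsuc))

∑-const : ∀ n c → ∑[ i < n ] c ≡ n * c
∑-const zero    c = refl
∑-const (suc n) c = cong (c +_) (∑-const n c)

∑-δ : ∀ {n} (x : Fin n) (g : Fin n → ℕ) → ∑[ i < n ] (if does (i ≟ x) then g i else 0) ≡ g x
∑-δ {suc n} fzero    g = trans (cong (g fzero +_) (sum-replicate-zero n)) (+-identityʳ _)
∑-δ {suc n} (fsuc x) g = ∑-δ x (g ∘ fsuc)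

∑-δ× : ∀ {n} {P : Set} (P? : Dec P) (x : Fin n) (g : Fin n → ℕ) →
       ∑[ i < n ] (if does (P? ×-dec (i ≟ x)) then g i else 0) ≡ (if does P? then g x else 0)
∑-δ× {n} (yes _) x g = ∑-δ x g
∑-δ× {n} (no _)  x g = sum-replicate-zero n

sum-allFin : ∀ n (f : Fin n → ℕ) → List.sum (map f (allFin n)) ≡ sum f
sum-allFin n f = trans (cong List.sum (List.map-tabulate id f)) (go n f)
  where
  go : ∀ n (f : Fin n → ℕ) → List.sum (tabulate f) ≡ sum f
  go zero    f = refl
  go (suc n) f = cong (f fzero +_) (go n (f ∘ fsuc))

indicator-yes : ∀ {P : Set} (P? : Dec P) {x} → P → (if does P? then x else 0) ≡ x
indicator-yes P? {x} p = cong (λ b → if b then x else 0) (dec-true P? p)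

indicator-no : ∀ {P : Set} (P? : Dec P) {x} → ¬ P → (if does P? then x else 0) ≡ 0
indicator-no P? {x} ¬p = cong (λ b → if b then x else 0) (dec-false P? ¬p)

indicator-disjoint-≤ : ∀ {P Q : Set} (P? : Dec P) (Q? : Dec Q) (r : Bool) x →
                       (P → r ≡ true) → (Q → r ≡ true) → (P → ¬ Q) →
                       (if does P? then x else 0) + (if does Q? then x else 0) ≤ (if r then x else 0)
indicator-disjoint-≤ (yes p) (yes q) r x P⇒r Q⇒r P⇒¬Q = contradiction q (P⇒¬Q p)
indicator-disjoint-≤ (yes p) (no _)  r x P⇒r Q⇒r P⇒¬Q rewrite P⇒r p = ≤-reflexive (+-identityʳ x)
indicator-disjoint-≤ (no _)  (yes q) r x P⇒r Q⇒r P⇒¬Q rewrite Q⇒r q = ≤-refl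
indicator-disjoint-≤ (no _)  (no _)  r x P⇒r Q⇒r P⇒¬Q = z≤n

∑ℕ : ℕ → (ℕ → ℕ) → ℕ
∑ℕ d f = ∑[ k < d ] f (toℕ k)

∑ℕ-cong : ∀ d {f g : ℕ → ℕ} → (∀ k → k < d → f k ≡ g k) → ∑ℕ d f ≡ ∑ℕ d g
∑ℕ-cong d f≡g = sum-cong-≗ (λ k → f≡g (toℕ k) (toℕ<n k))

∑ℕ-last : ∀ d (f : ℕ → ℕ) → ∑ℕ (suc d) f ≡ ∑ℕ d f + f d
∑ℕ-last zero    f = +-identityʳ (f 0)
∑ℕ-last (suc d) f = trans (cong (f 0 +_) (∑ℕ-last d (f ∘ suc))) (≡.sym (+-assoc (f 0) _ _))

∑ℕ-distrib-+ : ∀ d (f g : ℕ → ℕ) → ∑ℕ d (λ k → f k + g k) ≡ ∑ℕ d f + ∑ℕ d g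
∑ℕ-distrib-+ d f g = ∑-distrib-+ {d} (f ∘ toℕ) (g ∘ toℕ)

∑ℕ-vanish : ∀ d {g : ℕ → ℕ} → (∀ k → k < d → g k ≡ 0) → ∑ℕ d g ≡ 0
∑ℕ-vanish d g≡0 = trans (∑ℕ-cong d g≡0) (sum-replicate-zero d)

∑ℕ-single : ∀ d {m} (g : ℕ → ℕ) → m < d → (∀ k → k < d → k ≢ m → g k ≡ 0) → ∑ℕ d g ≡ g m
∑ℕ-single (suc d) {m} g m<d others with m ≟ℕ d
... | yes refl = trans (∑ℕ-last d g)
                   (cong (_+ g m) (∑ℕ-vanish d (λ k k<d → others k (m<n⇒m<1+n k<d) (<⇒≢ k<d))))
... | no m≢d = begin
  ∑ℕ (suc d) g    ≡⟨ ∑ℕ-last d g ⟩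
  ∑ℕ d g + g d    ≡⟨ cong₂ _+_ (∑ℕ-single d g m<d′ (λ k k<d → others k (m<n⇒m<1+n k<d)))
                               (others d ≤-refl (≢-sym m≢d)) ⟩
  g m + 0         ≡⟨ +-identityʳ (g m) ⟩
  g m             ∎
  where
  open ≡-Reasoning
  m<d′ : m < d
  m<d′ = ≤∧≢⇒< (s≤s⁻¹ m<d) m≢d

≤-foldr-⊔ : ∀ {x xs} → x ∈ xs → x ≤ foldr _⊔_ 0 xs
≤-foldr-⊔ {xs = y ∷ ys} (here refl) = m≤m⊔n y _
≤-foldr-⊔ {xs = y ∷ ys} (there x∈ys) = ≤-trans (≤-foldr-⊔ x∈ys) (m≤n⊔m y _)

foldr-⊔-∈ : ∀ xs → 0 < foldr _⊔_ 0 xs → foldr _⊔_ 0 xs ∈ xs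
foldr-⊔-∈ (x ∷ xs) pos with ⊔-sel x (foldr _⊔_ 0 xs)
... | inj₁ eq = here eq
... | inj₂ eq = there (subst (_∈ xs) (≡.sym eq) (foldr-⊔-∈ xs (subst (0 <_) eq pos)))

module _ {n : ℕ} (G : Graph n) where

  Adj-sym : ∀ {u v} → Adj G u v → Adj G v u
  Adj-sym {u} {v} u~v = trans (sym G v u) u~v

  Adj⇒≢ : ∀ {u v} → Adj G u v → u ≢ v
  Adj⇒≢ {u} u~u refl with trans (≡.sym (irrefl G u)) u~u
  ... | ()

  Chain-∷ʳ : ∀ xs {t t′} → Chain G (xs ++ t ∷ []) → Adj G t t′ → Chain G ((xs ++ t ∷ []) ++ t′ ∷ [])
  Chain-∷ʳ []           _       a = a , tt
  Chain-∷ʳ (x ∷ [])     (a′ , _) a = a′ , a , tt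
  Chain-∷ʳ (x ∷ y ∷ xs) (a′ , c) a = a′ , Chain-∷ʳ (y ∷ xs) c a

module _ {n : ℕ} {G : Graph n} where

  _++ʷ_ : ∀ {u v w k l} → Walk G u v k → Walk G v w l → Walk G u w (k + l)
  nil       ++ʷ q = q
  cons a p ++ʷ q = cons a (p ++ʷ q)

  _∷ʳʷ_ : ∀ {u v w k} → Walk G u v k → Adj G v w → Walk G u w (suc k)
  nil       ∷ʳʷ a = cons a nil
  cons a′ p ∷ʳʷ a = cons a′ (p ∷ʳʷ a)

  reverseʷ : ∀ {u v k} → Walk G u v k → Walk G v u k
  reverseʷ nil        = nil
  reverseʷ (cons a p) = reverseʷ p ∷ʳʷ Adj-sym G a

  Walk₀⇒≡ : ∀ {u v k} → Walk G u v k → k ≡ 0 → u ≡ v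
  Walk₀⇒≡ nil _ = refl

  next : ∀ {u v k} → Walk G u v k → Fin n
  next {u} nil               = u
  next (cons {w = w} _ _) = w

  next-step : ∀ {u v k m} (p : Walk G u v k) → k ≡ suc m → Adj G u (next p) × Walk G (next p) v m
  next-step (cons a p) refl = a , p

module Distance {n : ℕ} (G : Graph n) (dist : Fin n → Fin n → ℕ)
                (isDist : ∀ u v → IsDist G u v (dist u v)) where

  shortest : ∀ u v → Walk G u v (dist u v)
  shortest u v = proj₁ (isDist u v)

  dist-minimal : ∀ {u v m} → Walk G u v m → dist u v ≤ m
  dist-minimal {u} {v} p = proj₂ (isDist u v) _ p

  dist-triangle : ∀ u v w → dist u w ≤ dist u v + dist v w
  dist-triangle u v w = dist-minimal (shortest u v ++ʷ shortest v w)

  dist-sym : ∀ u v → dist u v ≡ dist v u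
  dist-sym u v = ≤-antisym (dist-minimal (reverseʷ (shortest v u)))
                           (dist-minimal (reverseʷ (shortest u v)))

  dist-refl : ∀ u → dist u u ≡ 0
  dist-refl u = n≤0⇒n≡0 (dist-minimal nil)

  dist≡0⇒≡ : ∀ {u v} → dist u v ≡ 0 → u ≡ v
  dist≡0⇒≡ {u} {v} = Walk₀⇒≡ (shortest u v)

  dist-adj : ∀ {u v} w → Adj G u v → dist u w ≤ suc (dist v w)
  dist-adj w u~v = dist-minimal (cons u~v (shortest _ w))

module Eccentricity {n : ℕ} (G : Graph n) (dist : Fin n → Fin n → ℕ) where

  dist≤ecc : ∀ u v → dist u v ≤ ecc G dist v
  dist≤ecc u v = ≤-foldr-⊔ (∈-map⁺ (λ u → dist u v) (∈-allFin u))

  ecc≤diameter : ∀ v → ecc G dist v ≤ diameter G dist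
  ecc≤diameter v = ≤-foldr-⊔ (∈-map⁺ (ecc G dist) (∈-allFin v))

  diameter-attained : 0 < diameter G dist → ∃[ u ] ∃[ v ] dist u v ≡ diameter G dist
  diameter-attained pos with ∈-map⁻ (ecc G dist) (foldr-⊔-∈ (map (ecc G dist) (allFin n)) pos)
  ... | v , _ , diam≡ecc with ∈-map⁻ (λ u → dist u v)
                               (foldr-⊔-∈ (map (λ u → dist u v) (allFin n)) (subst (0 <_) diam≡ecc pos))
  ...   | u , _ , ecc≡dist = u , v , ≡.sym (trans diam≡ecc ecc≡dist)

module RootedTree {n : ℕ} (T : Graph n) (acyclic : Acyclic T) (dist : Fin n → Fin n → ℕ)
                  (isDist : ∀ u v → IsDist T u v (dist u v)) (root : Fin n) where

  open Distance T dist isDist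

  level : Fin n → ℕ
  level v = dist v root

  -- the root is its own parent
  parent : Fin n → Fin n
  parent v = next (shortest v root)

  parent-adj : ∀ {v m} → level v ≡ suc m → Adj T v (parent v)
  parent-adj {v} eq = proj₁ (next-step (shortest v root) eq)

  level-parent : ∀ {v m} → level v ≡ suc m → level (parent v) ≡ m
  level-parent {v} {m} eq = ≤-antisym (dist-minimal (proj₂ (next-step (shortest v root) eq)))
    (s≤s⁻¹ (subst (_≤ suc (level (parent v))) eq (dist-adj root (parent-adj eq))))

  level-nonroot : ∀ {v} → v ≢ root → level v ≡ suc (level (parent v))
  level-nonroot {v} v≢root = by-level (level v) refl
    where
    by-level : ∀ k → level v ≡ k → level v ≡ suc (level (parent v))
    by-level zero    eq = contradiction (dist≡0⇒≡ eq) v≢root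
    by-level (suc m) eq = trans eq (cong suc (≡.sym (level-parent eq)))

  level-root : level root ≡ 0
  level-root = dist-refl root

  Lower : ℕ → List (Fin n) → Set
  Lower k = All (λ w → level w < k)

  -- Closed up by an edge st or by a common neighbour of s and t above level k, such a path is a cycle.
  record LowPath (k : ℕ) (s t : Fin n) : Set where
    field
      inner    : List (Fin n)
      unique   : Unique (s ∷ inner ++ t ∷ [])
      chain    : Chain T (s ∷ inner ++ t ∷ [])
      lower    : Lower k inner
      nonempty : 1 ≤ length inner

  higher-∉ : ∀ {s k} xs → level s ≡ k → Lower k xs → All (s ≢_) xs
  higher-∉ []       _  []         = []
  higher-∉ (x ∷ xs) ls (lx ∷ lxs) = (λ { refl → <-irrefl ls lx }) ∷ higher-∉ xs ls lxs

  Unique-between : ∀ {s t k} xs → level s ≡ k → level t ≡ k → s ≢ t → Lower k xs →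
                   Unique xs → Unique (s ∷ xs ++ t ∷ [])
  Unique-between {s} {t} xs ls lt s≢t low u =
    All.++⁺ (higher-∉ xs ls low) (s≢t ∷ [])
    ∷ AllPairs.++⁺ u ([] ∷ [])
                   (All.map (λ t≢x → (λ x≡t → t≢x (≡.sym x≡t)) ∷ []) (higher-∉ xs lt low))

  lowPath : ∀ k {s t} → level s ≡ k → level t ≡ k → s ≢ t → LowPath k s t
  lowPath zero    ls lt s≢t = contradiction (trans (dist≡0⇒≡ ls) (≡.sym (dist≡0⇒≡ lt))) s≢t
  lowPath (suc k) {s} {t} ls lt s≢t with parent s ≟ parent t
  ... | yes ps≡pt = record
    { inner    = parent s ∷ []
    ; unique   = Unique-between (parent s ∷ []) ls lt s≢t (low-s ∷ []) ([] ∷ [])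
    ; chain    = parent-adj ls , subst (λ x → Adj T x t) (≡.sym ps≡pt) (Adj-sym T (parent-adj lt)) , tt
    ; lower    = low-s ∷ []
    ; nonempty = s≤s z≤n
    }
    where
    low-s : level (parent s) < suc k
    low-s = ≤-reflexive (cong suc (level-parent ls))
  ... | no ps≢pt = record
    { inner    = parent s ∷ P.inner ++ parent t ∷ []
    ; unique   = Unique-between (parent s ∷ P.inner ++ parent t ∷ []) ls lt s≢t low P.unique
    ; chain    = parent-adj ls , Chain-∷ʳ T (parent s ∷ P.inner) P.chain (Adj-sym T (parent-adj lt))
    ; lower    = low
    ; nonempty = s≤s z≤n
    }
    where
    module P = LowPath (lowPath k (level-parent ls) (level-parent lt) ps≢pt)
    low : Lower (suc k) (parent s ∷ P.inner ++ parent t ∷ [])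
    low = ≤-reflexive (cong suc (level-parent ls))
        ∷ All.++⁺ (All.map m≤n⇒m≤1+n P.lower) (≤-reflexive (cong suc (level-parent lt)) ∷ [])

  adj⇒level≢ : ∀ {u v} → Adj T u v → level u ≢ level v
  adj⇒level≢ {u} {v} u~v eq = acyclic (u , P.inner ++ v ∷ [] , P.unique , two , cycle)
    where
    module P = LowPath (lowPath (level v) eq refl (Adj⇒≢ T u~v))
    two : 2 ≤ length (P.inner ++ v ∷ [])
    two = subst (2 ≤_) (≡.sym (trans (List.length-++ P.inner) (+-comm _ 1))) (s≤s P.nonempty)
    cycle : Chain T (u ∷ (P.inner ++ v ∷ []) ++ u ∷ [])
    cycle = Chain-∷ʳ T (u ∷ P.inner) P.chain (Adj-sym T u~v)

  adj⇒level-step : ∀ {u v} → Adj T u v → level u ≡ suc (level v) ⊎ level v ≡ suc (level u)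
  adj⇒level-step {u} {v} u~v with <-cmp (level u) (level v)
  ... | tri< lu<lv _ _ = inj₂ (≤-antisym (dist-adj root (Adj-sym T u~v)) lu<lv)
  ... | tri≈ _ eq _    = contradiction eq (adj⇒level≢ u~v)
  ... | tri> _ _ lu>lv = inj₁ (≤-antisym (dist-adj root u~v) lu>lv)

  parent-unique : ∀ {v u} → Adj T v u → level v ≡ suc (level u) → u ≡ parent v
  parent-unique {v} {u} v~u lv with u ≟ parent v
  ... | yes u≡pv = u≡pv
  ... | no u≢pv = contradiction (v , cycle , unique , two , chain) acyclic
    where
    module P = LowPath (lowPath (level u) refl (level-parent lv) u≢pv)
    cycle : List (Fin n)
    cycle = u ∷ P.inner ++ parent v ∷ []
    unique : Unique (v ∷ cycle)
    unique = higher-∉ cycle lv (≤-refl ∷ All.++⁺ (All.map m<n⇒m<1+n P.lower)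
                                                  (≤-reflexive (cong suc (level-parent lv)) ∷ []))
           ∷ P.unique
    two : 2 ≤ length cycle
    two = s≤s (subst (1 ≤_) (≡.sym (trans (List.length-++ P.inner) (+-comm _ 1))) (s≤s z≤n))
    chain : Chain T (v ∷ cycle ++ v ∷ [])
    chain = v~u , Chain-∷ʳ T (u ∷ P.inner) P.chain (Adj-sym T (parent-adj lv))

  level>0⇒nonroot : ∀ {v} → 0 < level v → v ≢ root
  level>0⇒nonroot pos refl = <-irrefl (≡.sym level-root) pos

  level-iterate : ∀ m {v} → m ≤ level v → level (iterate parent v m) ≡ level v ∸ m
  level-iterate zero    _   = refl
  level-iterate (suc m) {v} m<lv =
    trans (level-iterate m (s≤s⁻¹ (subst (suc m ≤_) lv m<lv))) (≡.sym (cong (_∸ suc m) lv))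
    where
    lv : level v ≡ suc (level (parent v))
    lv = level-nonroot (level>0⇒nonroot (≤-trans (s≤s z≤n) m<lv))

  geodesic-ancestor : ∀ {v w x y} → Walk T v w x → Walk T w root y → x + y ≡ level v →
                      w ≡ iterate parent v x
  geodesic-ancestor nil _ _ = refl
  geodesic-ancestor {v} {x = suc x} {y} (cons {w = u} v~u p) q len with adj⇒level-step v~u
  ... | inj₁ lv = trans (geodesic-ancestor p q (suc-injective (trans len lv)))
                        (cong (λ z → iterate parent z x) (parent-unique v~u lv))
  ... | inj₂ lu = contradiction (dist-minimal (p ++ʷ q)) (<⇒≱ x+y<lu)
    where
    x+y<lu : x + y < level u
    x+y<lu = subst (x + y <_) (≡.sym (trans lu (cong suc (≡.sym len)))) (m<n⇒m<1+n (n<1+n (x + y)))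

  walk-parity : ∀ {u w L} → Walk T u w L → ∃[ t ] level u + L + level w ≡ 2 * t
  walk-parity {u} nil = level u , double (level u)
    where
    double : ∀ a → a + 0 + a ≡ 2 * a
    double = solve-∀
  walk-parity {u} {w} {suc L} (cons {w = v} u~v p) with walk-parity p | adj⇒level-step u~v
  ... | t , eq | inj₁ lu = suc t , (begin
    level u + suc L + level w         ≡⟨ cong (λ z → z + suc L + level w) lu ⟩
    suc (level v) + suc L + level w   ≡⟨ shift (level v) L (level w) ⟩
    2 + (level v + L + level w)       ≡⟨ cong (2 +_) eq ⟩
    2 + 2 * t                         ≡⟨ *-distribˡ-+ 2 1 t ⟨
    2 * suc t                         ∎)
    where
    open ≡-Reasoning
    shift : ∀ a b c → suc a + suc b + c ≡ 2 + (a + b + c)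
    shift = solve-∀
  ... | t , eq | inj₂ lv = t , (begin
    level u + suc L + level w         ≡⟨ cong (_+ level w) (+-suc (level u) L) ⟩
    suc (level u) + L + level w       ≡⟨ cong (λ z → z + L + level w) lv ⟨
    level v + L + level w             ≡⟨ eq ⟩
    2 * t                             ∎)
    where open ≡-Reasoning

  NonRoot? : (v : Fin n) → Dec (v ≢ root)
  NonRoot? v = ¬? (v ≟ root)

  ParentEdge? : (v w : Fin n) → Dec (v ≢ root × w ≡ parent v)
  ParentEdge? v w = NonRoot? v ×-dec (w ≟ parent v)

  parentEdge-adj : ∀ {v w} → v ≢ root × w ≡ parent v → Adj T v w
  parentEdge-adj (v≢r , refl) = parent-adj (level-nonroot v≢r)

  parentEdge-asym : ∀ {v w} → v ≢ root × w ≡ parent v → ¬ (w ≢ root × v ≡ parent w)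
  parentEdge-asym {v} {w} (v≢r , refl) (w≢r , v≡pw) =
    contradiction (trans (level-nonroot v≢r) (cong suc lw)) (m≢1+n+m (level v) {1})
    where
    lw : level w ≡ suc (level v)
    lw = trans (level-nonroot w≢r) (cong (λ x → suc (level x)) (≡.sym v≡pw))

  parentEdge-split : ∀ (f : Fin n → ℕ) v w →
    (if does (ParentEdge? v w) then f v else 0) + (if does (ParentEdge? w v) then f v else 0)
      ≤ (if adj T v w then f v else 0)
  parentEdge-split f v w = indicator-disjoint-≤ (ParentEdge? v w) (ParentEdge? w v) (adj T v w) (f v)
    parentEdge-adj (λ e → Adj-sym T (parentEdge-adj e)) parentEdge-asym

  degree-sum : ∀ (f : Fin n → ℕ) v → f v * degree T v ≡ ∑[ w < n ] (if adj T v w then f v else 0)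
  degree-sum f v = begin
    f v * degree T v                                    ≡⟨ cong (f v *_) (sum-allFin n _) ⟩
    f v * (∑[ w < n ] (if adj T v w then 1 else 0))      ≡⟨ *-distribˡ-sum {n} (f v) _ ⟩
    ∑[ w < n ] (f v * (if adj T v w then 1 else 0))      ≡⟨ sum-cong-≗ (λ w → *-indicator (adj T v w)) ⟩
    ∑[ w < n ] (if adj T v w then f v else 0)            ∎
    where
    open ≡-Reasoning
    *-indicator : ∀ b → f v * (if b then 1 else 0) ≡ (if b then f v else 0)
    *-indicator true  = *-identityʳ (f v)
    *-indicator false = *-zeroʳ (f v)

  ∑-parentEdges≤∑-degree : ∀ (f : Fin n → ℕ) →
    ∑[ w < n ] (if does (NonRoot? w) then f w + f (parent w) else 0) ≤ ∑[ v < n ] (f v * degree T v)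
  ∑-parentEdges≤∑-degree f = begin
    ∑[ w < n ] (if does (NonRoot? w) then f w + f (parent w) else 0)
      ≡⟨ sum-cong-≗ (λ w → if-distrib-+ (does (NonRoot? w))) ⟩
    ∑[ w < n ] ((if does (NonRoot? w) then f w else 0) + (if does (NonRoot? w) then f (parent w) else 0))
      ≡⟨ ∑-distrib-+ {n} _ _ ⟩
    (∑[ v < n ] (if does (NonRoot? v) then f v else 0)) + (∑[ w < n ] (if does (NonRoot? w) then f (parent w) else 0))
      ≡⟨ cong₂ _+_ (sum-cong-≗ (λ v → ≡.sym (∑-δ× (NonRoot? v) (parent v) (λ _ → f v))))
                   (sum-cong-≗ (λ w → ≡.sym (∑-δ× (NonRoot? w) (parent w) f))) ⟩
    (∑[ v < n ] (∑[ w < n ] up v w)) + (∑[ w < n ] (∑[ v < n ] down v w))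
      ≡⟨ cong ((∑[ v < n ] (∑[ w < n ] up v w)) +_) (∑-comm (λ w v → down v w)) ⟩
    (∑[ v < n ] (∑[ w < n ] up v w)) + (∑[ v < n ] (∑[ w < n ] down v w))
      ≡⟨ ∑-distrib-+ {n} _ _ ⟨
    ∑[ v < n ] ((∑[ w < n ] up v w) + (∑[ w < n ] down v w))
      ≡⟨ sum-cong-≗ {n} (λ v → ∑-distrib-+ {n} _ _) ⟨
    ∑[ v < n ] (∑[ w < n ] (up v w + down v w))
      ≤⟨ ∑-mono-≤ (λ v → ∑-mono-≤ (λ w → parentEdge-split f v w)) ⟩
    ∑[ v < n ] (∑[ w < n ] (if adj T v w then f v else 0))
      ≡⟨ sum-cong-≗ (λ v → degree-sum f v) ⟨
    ∑[ v < n ] (f v * degree T v) ∎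
    where
    open ≤-Reasoning
    up down : Fin n → Fin n → ℕ
    up   v w = if does (ParentEdge? v w) then f v else 0
    down v w = if does (ParentEdge? w v) then f v else 0
    if-distrib-+ : ∀ b {x y} → (if b then x + y else 0) ≡ (if b then x else 0) + (if b then y else 0)
    if-distrib-+ true  = refl
    if-distrib-+ false = refl

-- spineEcc d k is the eccentricity of the vertex at distance k from one end of the path P_{d+1},
-- so spineSum d, summed edge by edge, is ξᶜ(P_{d+1}).
spineEcc : ℕ → ℕ → ℕ
spineEcc d k = k ⊔ (d ∸ k)

spineEdge : ℕ → ℕ → ℕ
spineEdge d k = spineEcc d (suc k) + spineEcc d k

spineSum : ℕ → ℕ
spineSum d = ∑ℕ d (spineEdge d)

spineEcc-shift : ∀ d {k} → k ≤ d → spineEcc (2 + d) (suc k) ≡ suc (spineEcc d k)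
spineEcc-shift d {k} k≤d = cong (suc k ⊔_) (+-∸-assoc 1 k≤d)

spineEcc-end : ∀ d → spineEcc d d ≡ d
spineEcc-end d = trans (cong (d ⊔_) (n∸n≡0 d)) (⊔-identityʳ d)

spineSum-step : ∀ d → spineSum (2 + d) ≡ spineSum d + 6 * d + 6
spineSum-step d = begin
  spineSum (2 + d)
    ≡⟨ cong (spineEdge (2 + d) 0 +_) (∑ℕ-last d (λ k → spineEdge (2 + d) (suc k))) ⟩
  spineEdge (2 + d) 0 + (∑ℕ d (λ k → spineEdge (2 + d) (suc k)) + spineEdge (2 + d) (suc d))
    ≡⟨ cong₂ (λ x y → spineEdge (2 + d) 0 + (x + y)) (∑ℕ-cong d middle) last ⟩
  (suc d + (2 + d)) + (∑ℕ d (λ k → spineEdge d k + 2) + ((2 + d) + suc d))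
    ≡⟨ cong (λ x → (suc d + (2 + d)) + (x + ((2 + d) + suc d)))
            (trans (∑ℕ-distrib-+ d (spineEdge d) (λ _ → 2)) (cong (spineSum d +_) (∑-const d 2))) ⟩
  (suc d + (2 + d)) + ((spineSum d + d * 2) + ((2 + d) + suc d))
    ≡⟨ regroup d (spineSum d) ⟩
  spineSum d + 6 * d + 6 ∎
  where
  open ≡-Reasoning
  shift : ∀ a b → suc a + suc b ≡ a + b + 2
  shift = solve-∀
  middle : ∀ k → k < d → spineEdge (2 + d) (suc k) ≡ spineEdge d k + 2
  middle k k<d = trans (cong₂ _+_ (spineEcc-shift d k<d) (spineEcc-shift d (<⇒≤ k<d)))
                       (shift (spineEcc d (suc k)) (spineEcc d k))
  last : spineEdge (2 + d) (suc d) ≡ (2 + d) + suc d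
  last = cong₂ _+_ (spineEcc-end (2 + d)) (trans (spineEcc-shift d ≤-refl) (cong suc (spineEcc-end d)))
  regroup : ∀ d s → (suc d + (2 + d)) + ((s + d * 2) + ((2 + d) + suc d)) ≡ s + 6 * d + 6
  regroup = solve-∀

spineSum-even : ∀ h → spineSum (h * 2) ≡ 6 * h * h
spineSum-even zero    = refl
spineSum-even (suc h) = begin
  spineSum (2 + h * 2)                ≡⟨ spineSum-step (h * 2) ⟩
  spineSum (h * 2) + 6 * (h * 2) + 6  ≡⟨ cong (λ s → s + 6 * (h * 2) + 6) (spineSum-even h) ⟩
  6 * h * h + 6 * (h * 2) + 6         ≡⟨ expand h ⟩
  6 * suc h * suc h                   ∎
  where
  open ≡-Reasoning
  expand : ∀ h → 6 * h * h + 6 * (h * 2) + 6 ≡ 6 * suc h * suc h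
  expand = solve-∀

spineSum-odd : ∀ h → spineSum (1 + h * 2) ≡ 6 * h * h + 6 * h + 2
spineSum-odd zero    = refl
spineSum-odd (suc h) = begin
  spineSum (3 + h * 2)                                  ≡⟨ spineSum-step (1 + h * 2) ⟩
  spineSum (1 + h * 2) + 6 * (1 + h * 2) + 6            ≡⟨ cong (λ s → s + 6 * (1 + h * 2) + 6) (spineSum-odd h) ⟩
  6 * h * h + 6 * h + 2 + 6 * (1 + h * 2) + 6           ≡⟨ expand h ⟩
  6 * suc h * suc h + 6 * suc h + 2                     ∎
  where
  open ≡-Reasoning
  expand : ∀ h → 6 * h * h + 6 * h + 2 + 6 * (1 + h * 2) + 6 ≡ 6 * suc h * suc h + 6 * suc h + 2
  expand = solve-∀

module Diametral {n : ℕ} (T : Graph n) (acyclic : Acyclic T) (dist : Fin n → Fin n → ℕ)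
                 (isDist : ∀ u v → IsDist T u v (dist u v)) {a root : Fin n} {d : ℕ}
                 (dist-a-root : dist a root ≡ d) (dist≤d : ∀ u v → dist u v ≤ d) where

  open Distance T dist isDist
  open RootedTree T acyclic dist isDist root public
  open Eccentricity T dist

  ε : Fin n → ℕ
  ε = ecc T dist

  spine : ℕ → Fin n
  spine k = iterate parent a (d ∸ k)

  level-spine : ∀ {k} → k ≤ d → level (spine k) ≡ k
  level-spine {k} k≤d = begin
    level (iterate parent a (d ∸ k))  ≡⟨ level-iterate (d ∸ k) (subst (d ∸ k ≤_) (≡.sym dist-a-root) (m∸n≤m d k)) ⟩
    level a ∸ (d ∸ k)                 ≡⟨ cong (_∸ (d ∸ k)) dist-a-root ⟩
    d ∸ (d ∸ k)                       ≡⟨ m∸[m∸n]≡n k≤d ⟩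
    k                                 ∎
    where open ≡-Reasoning

  level≤ε : ∀ w → level w ≤ ε w
  level≤ε w = subst (_≤ ε w) (dist-sym root w) (dist≤ecc root w)

  d≤dist-a+level : ∀ w → d ≤ dist a w + level w
  d≤dist-a+level w = subst (_≤ dist a w + level w) dist-a-root (dist-triangle a w root)

  spineEcc≤ε : ∀ w → spineEcc d (level w) ≤ ε w
  spineEcc≤ε w = ⊔-lub (level≤ε w) (≤-trans d∸level≤dist (dist≤ecc a w))
    where
    d∸level≤dist : d ∸ level w ≤ dist a w
    d∸level≤dist = subst (d ∸ level w ≤_) (m+n∸n≡m (dist a w) (level w))
                         (∸-monoˡ-≤ (level w) (d≤dist-a+level w))

  spineEdge≤ε : ∀ w → w ≢ root → spineEdge d (pred (level w)) ≤ ε w + ε (parent w)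
  spineEdge≤ε w w≢r = subst (λ l → spineEdge d l ≤ ε w + ε (parent w)) (≡.sym (cong pred lw))
                        (+-mono-≤ (subst (λ l → spineEcc d l ≤ ε w) lw (spineEcc≤ε w)) (spineEcc≤ε (parent w)))
    where
    lw : level w ≡ suc (level (parent w))
    lw = level-nonroot w≢r

  -- Equality would put w on the geodesic from a to the root, i.e. on the spine; d + 1 is excluded by parity.
  off-spine-far : ∀ w → w ≢ spine (level w) → 2 + d ≤ dist a w + level w
  off-spine-far w w≢s with m≤n⇒m<n∨m≡n (d≤dist-a+level w)
  ... | inj₂ d≡ = contradiction (trans on-geodesic (cong (iterate parent a) steps)) w≢s
    where
    on-geodesic : w ≡ iterate parent a (dist a w)
    on-geodesic = geodesic-ancestor (shortest a w) (shortest w root) (trans (≡.sym d≡) (≡.sym dist-a-root))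
    steps : dist a w ≡ d ∸ level w
    steps = ≡.sym (trans (cong (_∸ level w) d≡) (m+n∸n≡m (dist a w) (level w)))
  ... | inj₁ d< with m≤n⇒m<n∨m≡n d<
  ...   | inj₁ 1+d< = 1+d<
  ...   | inj₂ 1+d≡ with walk-parity (shortest a w)
  ...     | t , even = contradiction (trans (≡.sym even) odd) (even≢odd t d)
    where
    odd : level a + dist a w + level w ≡ suc (2 * d)
    odd = begin
      level a + dist a w + level w    ≡⟨ +-assoc (level a) (dist a w) (level w) ⟩
      level a + (dist a w + level w)  ≡⟨ cong₂ _+_ dist-a-root (≡.sym 1+d≡) ⟩
      d + suc d                       ≡⟨ d+1+d d ⟩
      suc (2 * d)                     ∎
      where
      open ≡-Reasoning
      d+1+d : ∀ d → d + suc d ≡ suc (2 * d)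
      d+1+d = solve-∀

  OffSpineBound : ℕ → Set
  OffSpineBound B = ∀ w → w ≢ root → w ≢ spine (level w) → B ≤ ε w + ε (parent w)

  off-spine-edge : ∀ {B} → (∀ z p q → 2 + d ≤ z + z → z ≤ p → z ≤ suc q → B ≤ p + q) → OffSpineBound B
  off-spine-edge bound w w≢r w≢s =
    bound z (ε w) (ε (parent w)) far (⊔-lub (dist≤ecc a w) (level≤ε w)) (⊔-lub near-a near-root)
    where
    z : ℕ
    z = dist a w ⊔ level w
    lw : level w ≡ suc (level (parent w))
    lw = level-nonroot w≢r
    far : 2 + d ≤ z + z
    far = ≤-trans (off-spine-far w w≢s) (+-mono-≤ (m≤m⊔n (dist a w) (level w)) (m≤n⊔m (dist a w) (level w)))
    near-a : dist a w ≤ suc (ε (parent w))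
    near-a = ≤-trans (dist-minimal (shortest a (parent w) ∷ʳʷ Adj-sym T (parent-adj lw)))
                     (s≤s (dist≤ecc a (parent w)))
    near-root : level w ≤ suc (ε (parent w))
    near-root = subst (_≤ suc (ε (parent w))) (≡.sym lw) (s≤s (level≤ε (parent w)))

  OnSpine? : (w : Fin n) → Dec (w ≢ root × w ≡ spine (level w))
  OnSpine? w = NonRoot? w ×-dec (w ≟ spine (level w))

  spine-fibre : ∀ (f : ℕ → ℕ) w →
    ∑ℕ d (λ k → if does (w ≟ spine (suc k)) then f (suc k) else 0)
      ≡ (if does (OnSpine? w) then f (level w) else 0)
  spine-fibre f w = fibre (NonRoot? w) (w ≟ spine (level w))
    where
    g : ℕ → ℕ
    g k = if does (w ≟ spine (suc k)) then f (suc k) else 0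
    level-on : ∀ {k} → k < d → w ≡ spine (suc k) → level w ≡ suc k
    level-on k<d refl = level-spine k<d
    fibre : (r? : Dec (w ≢ root)) (s? : Dec (w ≡ spine (level w))) →
            ∑ℕ d g ≡ (if does (r? ×-dec s?) then f (level w) else 0)
    fibre (yes w≢r) (yes w≡s) =
      trans (∑ℕ-single d g m<d others) (trans (indicator-yes (w ≟ _) on-m) (cong f (≡.sym lw)))
      where
      lw : level w ≡ suc (level (parent w))
      lw = level-nonroot w≢r
      m<d : level (parent w) < d
      m<d = subst (_≤ d) lw (dist≤d w root)
      on-m : w ≡ spine (suc (level (parent w)))
      on-m = subst (λ l → w ≡ spine l) lw w≡s
      others : ∀ k → k < d → k ≢ level (parent w) → g k ≡ 0
      others k k<d k≢m =
        indicator-no (w ≟ _) (λ w≡sk → k≢m (suc-injective (trans (≡.sym (level-on k<d w≡sk)) lw)))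
    fibre (yes w≢r) (no w≢s) = ∑ℕ-vanish d (λ k k<d → indicator-no (w ≟ spine (suc k)) {f (suc k)}
                                 (λ w≡sk → w≢s (subst (λ l → w ≡ spine l) (≡.sym (level-on k<d w≡sk)) w≡sk)))
    fibre (no w≡r) _ = ∑ℕ-vanish d (λ k k<d → indicator-no (w ≟ spine (suc k)) {f (suc k)}
                         (λ w≡sk → w≡r (level>0⇒nonroot (subst (0 <_) (≡.sym (level-on k<d w≡sk)) (s≤s z≤n)))))

  ∑-spine : ∀ (f : ℕ → ℕ) → ∑[ w < n ] (if does (OnSpine? w) then f (level w) else 0) ≡ ∑ℕ d (f ∘ suc)
  ∑-spine f = begin
    ∑[ w < n ] (if does (OnSpine? w) then f (level w) else 0)
      ≡⟨ sum-cong-≗ (spine-fibre f) ⟨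
    ∑[ w < n ] (∑ℕ d (λ k → indicator w k))
      ≡⟨ ∑-comm {n} {d} (λ w k → indicator w (toℕ k)) ⟩
    ∑ℕ d (λ k → ∑[ w < n ] indicator w k)
      ≡⟨ sum-cong-≗ {d} (λ k → ∑-δ (spine (suc (toℕ k))) (λ _ → f (suc (toℕ k)))) ⟩
    ∑ℕ d (f ∘ suc) ∎
    where
    open ≡-Reasoning
    indicator : Fin n → ℕ → ℕ
    indicator w k = if does (w ≟ spine (suc k)) then f (suc k) else 0

  vertex-bound : ∀ B → OffSpineBound B → ∀ w →
    B + (if does (OnSpine? w) then spineEdge d (pred (level w)) else 0)
      ≤ (if does (NonRoot? w) then ε w + ε (parent w) else 0)
        + (if does (OnSpine? w) then B else 0) + (if does (w ≟ root) then B else 0)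
  vertex-bound B off w = by-cases (w ≟ root) (w ≟ spine (level w))
    where
    E : ℕ
    E = ε w + ε (parent w)
    by-cases : (r? : Dec (w ≡ root)) (s? : Dec (w ≡ spine (level w))) →
      B + (if does (¬? r? ×-dec s?) then spineEdge d (pred (level w)) else 0)
        ≤ (if does (¬? r?) then E else 0) + (if does (¬? r? ×-dec s?) then B else 0) + (if does r? then B else 0)
    by-cases (yes _)   _         = ≤-reflexive (+-identityʳ B)
    by-cases (no w≢r) (yes _)   = ≤-trans (≤-reflexive (+-comm B _))
                                    (≤-trans (+-monoˡ-≤ B (spineEdge≤ε w w≢r)) (m≤m+n (E + B) 0))
    by-cases (no w≢r) (no w≢s) = ≤-trans (+-mono-≤ (off w w≢r w≢s) z≤n) (m≤m+n (E + 0) 0)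

  -- (n − 1 − d) · B + spineSum d ≤ ξᶜ, with the subtracted terms moved to the right
  ξᶜ-count : ∀ B → OffSpineBound B → n * B + spineSum d ≤ ξᶜ T dist + d * B + B
  ξᶜ-count B off = begin
    n * B + spineSum d
      ≡⟨ cong₂ _+_ (∑-const n B) (∑-spine (spineEdge d ∘ pred)) ⟨
    ∑[ w < n ] B + ∑[ w < n ] S w
      ≡⟨ ∑-distrib-+ {n} _ _ ⟨
    ∑[ w < n ] (B + S w)
      ≤⟨ ∑-mono-≤ (vertex-bound B off) ⟩
    ∑[ w < n ] (E w + X w + R w)
      ≡⟨ trans (∑-distrib-+ {n} _ _) (cong (_+ ∑[ w < n ] R w) (∑-distrib-+ {n} _ _)) ⟩
    ∑[ w < n ] E w + ∑[ w < n ] X w + ∑[ w < n ] R w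
      ≤⟨ +-monoˡ-≤ _ (+-monoˡ-≤ _ (∑-parentEdges≤∑-degree ε)) ⟩
    ∑[ v < n ] (ε v * degree T v) + ∑[ w < n ] X w + ∑[ w < n ] R w
      ≡⟨ cong₂ (λ x y → x + y + ∑[ w < n ] R w)
               (≡.sym (sum-allFin n _)) (trans (∑-spine (λ _ → B)) (∑-const d B)) ⟩
    ξᶜ T dist + d * B + ∑[ w < n ] R w
      ≡⟨ cong (ξᶜ T dist + d * B +_) (∑-δ root (λ _ → B)) ⟩
    ξᶜ T dist + d * B + B ∎
    where
    open ≤-Reasoning
    S E X R : Fin n → ℕ
    S w = if does (OnSpine? w) then spineEdge d (pred (level w)) else 0
    E w = if does (NonRoot? w) then ε w + ε (parent w) else 0
    X w = if does (OnSpine? w) then B else 0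
    R w = if does (w ≟ root) then B else 0

even-half : ∀ d → d % 2 ≡ 0 → d ≡ (d / 2) * 2
even-half d d%2≡0 = trans (m≡m%n+[m/n]*n d 2) (cong (_+ (d / 2) * 2) d%2≡0)

odd-half : ∀ d → d % 2 ≡ 1 → d ≡ 1 + (d / 2) * 2
odd-half d d%2≡1 = trans (m≡m%n+[m/n]*n d 2) (cong (_+ (d / 2) * 2) d%2≡1)

edge-bound : ∀ d z p q → 2 + d ≤ z + z → z ≤ p → z ≤ suc q → suc d ≤ p + q
edge-bound d z p q 2+d≤2z z≤p z≤1+q =
  s≤s⁻¹ (≤-trans 2+d≤2z (≤-trans (+-mono-≤ z≤p z≤1+q) (≤-reflexive (+-suc p q))))

-- for odd d, z + z ≥ d + 2 forces z + z ≥ d + 3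
edge-bound-odd : ∀ d z p q → d % 2 ≡ 1 → 2 + d ≤ z + z → z ≤ p → z ≤ suc q → 2 + d ≤ p + q
edge-bound-odd d z p q d%2≡1 rewrite odd-half d d%2≡1 = halved (d / 2)
  where
  halved : ∀ h → 3 + h * 2 ≤ z + z → z ≤ p → z ≤ suc q → 3 + h * 2 ≤ p + q
  halved h 3+2h≤2z z≤p z≤1+q = s≤s⁻¹ (begin
    4 + h * 2                  ≡⟨ double h ⟨
    (2 + h) + (2 + h)          ≤⟨ +-mono-≤ (≤-trans 2+h≤z z≤p) (≤-trans 2+h≤z z≤1+q) ⟩
    p + suc q                  ≡⟨ +-suc p q ⟩
    suc (p + q)                ∎)
    where
    open ≤-Reasoning
    double : ∀ h → (2 + h) + (2 + h) ≡ 4 + h * 2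
    double = solve-∀
    twice : ∀ z → z + z ≡ z * 2
    twice = solve-∀
    2+h≤z : 2 + h ≤ z
    2+h≤z = *-cancelʳ-< 2 (suc h) z (subst (3 + h * 2 ≤_) (twice z) 3+2h≤2z)

volcano-even : ∀ n d x → d % 2 ≡ 0 → n * suc d + spineSum d ≤ x + d * suc d + suc d →
               2 * n * d + 2 * n + d * d ≤ 2 * x + 4 * d + 2
volcano-even n d x d%2≡0 rewrite even-half d d%2≡0 = halved (d / 2)
  where
  halved : ∀ h → n * suc (h * 2) + spineSum (h * 2) ≤ x + h * 2 * suc (h * 2) + suc (h * 2) →
           2 * n * (h * 2) + 2 * n + h * 2 * (h * 2) ≤ 2 * x + 4 * (h * 2) + 2
  halved h count = +-cancelʳ-≤ (8 * h * h) _ _ (begin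
    2 * n * (h * 2) + 2 * n + h * 2 * (h * 2) + 8 * h * h  ≡⟨ lhs n h ⟩
    2 * (n * suc (h * 2) + 6 * h * h)                      ≡⟨ cong (λ s → 2 * (n * suc (h * 2) + s)) (spineSum-even h) ⟨
    2 * (n * suc (h * 2) + spineSum (h * 2))               ≤⟨ *-monoʳ-≤ 2 count ⟩
    2 * (x + h * 2 * suc (h * 2) + suc (h * 2))            ≡⟨ rhs h x ⟩
    2 * x + 4 * (h * 2) + 2 + 8 * h * h                    ∎)
    where
    open ≤-Reasoning
    lhs : ∀ n h → 2 * n * (h * 2) + 2 * n + h * 2 * (h * 2) + 8 * h * h ≡ 2 * (n * suc (h * 2) + 6 * h * h)
    lhs = solve-∀
    rhs : ∀ h x → 2 * (x + h * 2 * suc (h * 2) + suc (h * 2)) ≡ 2 * x + 4 * (h * 2) + 2 + 8 * h * h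
    rhs = solve-∀

volcano-odd : ∀ n d x → d % 2 ≡ 1 → n * (2 + d) + spineSum d ≤ x + d * (2 + d) + (2 + d) →
              2 * n * d + 4 * n + d * d ≤ 2 * x + 6 * d + 3
volcano-odd n d x d%2≡1 rewrite odd-half d d%2≡1 = halved (d / 2)
  where
  halved : ∀ h → let o = 1 + h * 2 in n * (2 + o) + spineSum o ≤ x + o * (2 + o) + (2 + o) →
           2 * n * o + 4 * n + o * o ≤ 2 * x + 6 * o + 3
  halved h count = +-cancelʳ-≤ (8 * h * h + 8 * h + 3) _ _ (begin
    2 * n * o + 4 * n + o * o + (8 * h * h + 8 * h + 3)    ≡⟨ lhs n h ⟩
    2 * (n * (2 + o) + (6 * h * h + 6 * h + 2))            ≡⟨ cong (λ s → 2 * (n * (2 + o) + s)) (spineSum-odd h) ⟨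
    2 * (n * (2 + o) + spineSum o)                         ≤⟨ *-monoʳ-≤ 2 count ⟩
    2 * (x + o * (2 + o) + (2 + o))                        ≡⟨ rhs h x ⟩
    2 * x + 6 * o + 3 + (8 * h * h + 8 * h + 3)            ∎)
    where
    open ≤-Reasoning
    o : ℕ
    o = 1 + h * 2
    lhs : ∀ n h → 2 * n * (1 + h * 2) + 4 * n + (1 + h * 2) * (1 + h * 2) + (8 * h * h + 8 * h + 3)
                ≡ 2 * (n * (2 + (1 + h * 2)) + (6 * h * h + 6 * h + 2))
    lhs = solve-∀
    rhs : ∀ h x → 2 * (x + (1 + h * 2) * (2 + (1 + h * 2)) + (2 + (1 + h * 2)))
                ≡ 2 * x + 6 * (1 + h * 2) + 3 + (8 * h * h + 8 * h + 3)
    rhs = solve-∀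

corollary1 : (n : ℕ) (T : Graph n) → IsTree T →
    (dist : Fin n → Fin n → ℕ) → (∀ u v → IsDist T u v (dist u v)) →
    (d : ℕ) → diameter T dist ≡ d → 3 ≤ d →
    AtLeastVolcano n d (ξᶜ T dist)
corollary1 n T (_ , acyclic) dist isDist d diam≡d 3≤d =
    (λ even → volcano-even n d (ξᶜ T dist) even
                (ξᶜ-count (1 + d) (off-spine-edge (edge-bound d))))
  , (λ odd → volcano-odd n d (ξᶜ T dist) odd
               (ξᶜ-count (2 + d) (off-spine-edge (λ z p q → edge-bound-odd d z p q odd))))
  where
  open Eccentricity T dist
  dist≤d : ∀ u v → dist u v ≤ d
  dist≤d u v = ≤-trans (dist≤ecc u v) (subst (ecc T dist v ≤_) diam≡d (ecc≤diameter v))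
  diametral-pair : ∃[ u ] ∃[ v ] dist u v ≡ diameter T dist
  -- of d ≥ 3 only d > 0 is needed
  diametral-pair = diameter-attained (subst (0 <_) (≡.sym diam≡d) (≤-trans (s≤s z≤n) 3≤d))
  a root : Fin n
  a    = proj₁ diametral-pair
  root = proj₁ (proj₂ diametral-pair)
  open Diametral T acyclic dist isDist {a} {root} (trans (proj₂ (proj₂ diametral-pair)) diam≡d) dist≤d
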